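{- Let $p,q\geq 2$, $m=p+q$, and let $G=\Theta(s_1^{p}, s_{p+1},\ldots,s_{p+q})$ be a generalized theta graph with exactly $p$ paths having $s_1$ internal vertices and $q$ further paths having $s_{p+1}\le\cdots\le s_{p+q}$ internal vertices, where $s_1<s_{p+1}$. Then $\beta(G)\geq p+1$.
   Context: Graphs are simple, connected, finite. A set $W\subseteq V(G)$ is resolving if for any distinct $u,v$ there is $w\in W$ with $d(u,w)\ne d(v,w)$; $\beta(G)$ is the minimum size of a resolving set. A generalized theta graph consists of two vertices $c_1,c_2$ (centers) joined by internally disjoint paths; a path with $s$ internal vertices has length $s+1$. The exponent notation $s^p$ means that $p$ paths have $s$ internal vertices. -}

module Defs where

open import Data.Nat using (ℕ; zero; suc; _+_; _≤_; _<_)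
open import Data.Fin using (Fin; toℕ; splitAt)
open import Data.Sum using (_⊎_; inj₁; inj₂)
open import Data.Product using (Σ; _×_; ∃-syntax)
open import Data.List using (List; length)
open import Data.List.Membership.Propositional using (_∈_)
open import Relation.Binary.PropositionalEquality using (_≡_)
open import Relation.Nullary using (¬_)

record Graph : Set₁ where
  field
    V   : Set
    Adj : V → V → Set

module _ (G : Graph) where
  open Graph G

  data Walk : V → V → ℕ → Set where
    [] : ∀ {u} → Walk u u 0
    _∷_ : ∀ {u v w k} → Adj u v → Walk v w k → Walk u w (suc k)

  Dist : V → V → ℕ → Set
  Dist u v k = Walk u v k × (∀ l → Walk u v l → k ≤ l)

  Resolving : List V → Set
  Resolving W = ∀ u v → ¬ (u ≡ v) →
    ∃[ w ] (w ∈ W × ∃[ a ] ∃[ b ] (Dist u w a × Dist v w b × ¬ (a ≡ b)))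

  MetricDimAtLeast : ℕ → Set
  MetricDimAtLeast n = ∀ W → Resolving W → n ≤ length W

-- Generalized theta graph with m paths; path i has s i internal vertices
-- int i 0, …, int i (s i - 1), in order from c₁ to c₂.

data ThetaV {m : ℕ} (s : Fin m → ℕ) : Set where
  c₁ c₂ : ThetaV s
  int : (i : Fin m) → Fin (s i) → ThetaV s

data ThetaEdge {m : ℕ} (s : Fin m → ℕ) : ThetaV s → ThetaV s → Set where
  direct : (i : Fin m) → s i ≡ 0 → ThetaEdge s c₁ c₂
  start  : (i : Fin m) (j : Fin (s i)) → toℕ j ≡ 0 → ThetaEdge s c₁ (int i j)
  step   : (i : Fin m) (j k : Fin (s i)) → toℕ k ≡ suc (toℕ j) →
           ThetaEdge s (int i j) (int i k)
  end    : (i : Fin m) (j : Fin (s i)) → suc (toℕ j) ≡ s i →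
           ThetaEdge s (int i j) c₂

Theta : {m : ℕ} → (Fin m → ℕ) → Graph
Theta s = record
  { V = ThetaV s
  ; Adj = λ u v → ThetaEdge s u v ⊎ ThetaEdge s v u
  }

-- Θ(s₁^p, t₀, …, t_{q-1}): the first p paths have s₁ internal vertices,
-- path p + j has t j internal vertices.
lengths : (p q : ℕ) → ℕ → (Fin q → ℕ) → Fin (p + q) → ℕ
lengths p q s₁ t i with splitAt p i
... | inj₁ _ = s₁
... | inj₂ j = t j

-- Let x and y be the neighbours of the same centre c on two paths a ≠ b with s_a ≤ s_b, and let c′ be
-- the other centre. A walk from x to a vertex w off path a passes c after 1 step or c′ after s_a steps,
-- and likewise for y with s_b. Hence d(x, w) ≤ d(y, w); the reverse inequality holds if s_a = s_b, or
-- if w prefers c, meaning that going around path a to c′ never beats going to c directly. Every vertex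
-- prefers one of the centres, and a vertex on a path with at most s_a internal vertices prefers both.
-- Now let |W| ≤ p. If W lies on the short paths, the c₁-neighbours on two long paths are not resolved.
-- If exactly one vertex e of W is off the short paths, some short path and some long path miss W, and
-- the neighbours of the centre preferred by e are not resolved. Otherwise two short paths miss W and
-- their c₁-neighbours are not resolved.

module Submission where

open import Defs
open import Data.Nat using (ℕ; zero; suc; _+_; _∸_; _≤_; _<_; z≤n; s≤s; s≤s⁻¹)
open import Data.Nat.Properties
open import Data.Fin using (Fin; toℕ; fromℕ<; splitAt; opposite; _↑ˡ_; _↑ʳ_)
import Data.Fin as F
import Data.Fin.Properties as FinP
open import Data.Sum using (_⊎_; inj₁; inj₂; [_,_]′; isInj₁)
import Data.Sum as Sum
open import Data.Product using (Σ-syntax; ∃-syntax; ∃₂; _×_; _,_; proj₁)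
open import Data.Maybe using (Maybe; just; nothing)
open import Data.List using (List; []; _∷_; length; lookup; mapMaybe)
open import Data.List.Membership.Propositional using (_∈_; _∉_)
import Data.List.Membership.DecPropositional as DecMembership
open import Data.List.Relation.Unary.Any using (here; there)
import Data.List.Relation.Unary.Any as Any
open import Data.List.Relation.Unary.Any.Properties using (lookup-index)
open import Data.List.Relation.Unary.All as All using (All; []; _∷_)
open import Data.Empty using (⊥-elim)
open import Function using (_∘_)
open import Relation.Binary.PropositionalEquality
open import Relation.Nullary using (¬_; yes; no)

module _ {A B : Set} (f : A → Maybe B) where

  rejected : List A → List A
  rejected [] = []
  rejected (a ∷ as) with f a
  ... | just _  = rejected as
  ... | nothing = a ∷ rejected as

  length-mapMaybe+rejected : ∀ as → length (mapMaybe f as) + length (rejected as) ≡ length as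
  length-mapMaybe+rejected [] = refl
  length-mapMaybe+rejected (a ∷ as) with f a
  ... | just _  = cong suc (length-mapMaybe+rejected as)
  ... | nothing = trans (+-suc _ _) (cong suc (length-mapMaybe+rejected as))

  ∈-mapMaybe : ∀ {a as b} → a ∈ as → f a ≡ just b → b ∈ mapMaybe f as
  ∈-mapMaybe {as = a ∷ _} (here refl) fa≡b rewrite fa≡b = here refl
  ∈-mapMaybe {as = a′ ∷ _} (there a∈as) fa≡b with f a′
  ... | just _  = there (∈-mapMaybe a∈as fa≡b)
  ... | nothing = ∈-mapMaybe a∈as fa≡b

  ∈-rejected : ∀ {a as} → a ∈ as → f a ≡ nothing → a ∈ rejected as
  ∈-rejected {as = a ∷ _} (here refl) fa≡nothing rewrite fa≡nothing = here refl
  ∈-rejected {as = a′ ∷ _} (there a∈as) fa≡nothing with f a′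
  ... | just _  = ∈-rejected a∈as fa≡nothing
  ... | nothing = there (∈-rejected a∈as fa≡nothing)

isInj₁≡just⇒≡inj₁ : ∀ {A B : Set} {a : A} (u : A ⊎ B) → isInj₁ u ≡ just a → u ≡ inj₁ a
isInj₁≡just⇒≡inj₁ (inj₁ _) refl = refl

∃∉-of-length< : ∀ {n} (xs : List (Fin n)) → length xs < n → ∃[ i ] i ∉ xs
∃∉-of-length< {n} xs |xs|<n = FinP.¬∀⟶∃¬ n (_∈ xs) (λ i → DecMembership._∈?_ FinP._≟_ i xs) not-all
  where
  not-all : ¬ (∀ i → i ∈ xs)
  not-all i∈xs with FinP.pigeonhole |xs|<n (Any.index ∘ i∈xs)
  ... | i , j , i<j , same-index = FinP.<-irrefl i≡j i<j
    where
    i≡j : i ≡ j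
    i≡j = trans (lookup-index (i∈xs i))
                (trans (cong (lookup xs) same-index) (sym (lookup-index (i∈xs j))))

two-∉-of-length : ∀ {n} (xs : List (Fin n)) → 2 + length xs ≤ n →
                  ∃₂ λ i j → i ≢ j × i ∉ xs × j ∉ xs
two-∉-of-length xs 2+|xs|≤n
  with i , i∉xs ← ∃∉-of-length< xs (≤-trans (n≤1+n _) 2+|xs|≤n)
  with j , j∉i∷xs ← ∃∉-of-length< (i ∷ xs) 2+|xs|≤n
  = i , j , (λ i≡j → j∉i∷xs (here (sym i≡j))) , i∉xs , j∉i∷xs ∘ there

two-ordered-indices : ∀ {q} (t : Fin q → ℕ) → (∀ i j → i F.≤ j → t i ≤ t j) → 2 ≤ q →
                      ∃₂ λ y y′ → y ≢ y′ × t y ≤ t y′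
two-ordered-indices t t-mono (s≤s (s≤s z≤n)) =
  F.zero , F.suc F.zero , (λ ()) , t-mono F.zero (F.suc F.zero) z≤n

toℕ+suc-toℕ-opposite : ∀ {n} (j : Fin n) → toℕ j + suc (toℕ (opposite j)) ≡ n
toℕ+suc-toℕ-opposite {n} j = begin
  toℕ j + suc (toℕ (opposite j))  ≡⟨ +-suc (toℕ j) _ ⟩
  suc (toℕ j + toℕ (opposite j))  ≡⟨ cong (suc (toℕ j) +_) (FinP.opposite-prop j) ⟩
  suc (toℕ j) + (n ∸ suc (toℕ j)) ≡⟨ m+[n∸m]≡n (FinP.toℕ<n j) ⟩
  n                               ∎
  where open ≡-Reasoning

module GraphWalks (G : Graph) where
  open Graph G

  infixr 5 _++ʷ_
  _++ʷ_ : ∀ {u v w a b} → Walk G u v a → Walk G v w b → Walk G u w (a + b)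
  [] ++ʷ q = q
  (e ∷ p) ++ʷ q = e ∷ (p ++ʷ q)

  reverse : (∀ {u v} → Adj u v → Adj v u) → ∀ {u v a} → Walk G u v a → Walk G v u a
  reverse adj-sym [] = []
  reverse adj-sym (_∷_ {k = a} e p) =
    subst (Walk G _ _) (+-comm a 1) (reverse adj-sym p ++ʷ (adj-sym e ∷ []))

  Through : V → ℕ → V → ℕ → Set
  Through c n w l = ∃[ l′ ] (Walk G c w l′ × n + l′ ≤ l)

  through-≤ : ∀ {c n w l} → Through c n w l → n ≤ l
  through-≤ {n = n} (_ , _ , n+l′≤l) = m+n≤o⇒m≤o n n+l′≤l

  through-mono : ∀ {c n n′ w l l′} → n ≤ n′ → l′ ≤ l → Through c n′ w l′ → Through c n w l
  through-mono n≤n′ l′≤l (k , q , n′+k≤l′) = k , q , ≤-trans (+-monoˡ-≤ k n≤n′) (≤-trans n′+k≤l′ l′≤l)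

  through-suc : ∀ {c n w l} → Through c n w l → Through c (suc n) w (suc l)
  through-suc (k , q , n+k≤l) = k , q , s≤s n+k≤l

  dist-≤-through : ∀ {x c n w l d} → Walk G x c n → Through c n w l → Dist G x w d → d ≤ l
  dist-≤-through x→c (_ , c→w , h) (_ , shortest) = ≤-trans (shortest _ (x→c ++ʷ c→w)) h

  -- From a neighbour of c that is A steps from c′, routes to w through c′ are never shorter
  -- than routes through c.
  Prefers : V → V → ℕ → V → Set
  Prefers c c′ A w = ∀ {l} → Through c′ A w l → Through c 1 w l

  prefers-self : ∀ {c c′ A} → 1 ≤ A → Prefers c c′ A c
  prefers-self {A = A} 1≤A (_ , _ , A+l′≤l) = 0 , [] , ≤-trans 1≤A (m+n≤o⇒m≤o A A+l′≤l)

  prefers-of-walks : ∀ {c c′ x A a b} → 1 ≤ A → a < A + b → Walk G c x a →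
                     (∀ {l} → Walk G c′ x l → a ≤ l ⊎ b ≤ l) → Prefers c c′ A x
  prefers-of-walks {A = A} {a} {b} 1≤A a<A+b c→x bound (l′ , c′→x , A+l′≤l) =
    a , c→x , ≤-trans (1+a≤A+l′ (bound c′→x)) A+l′≤l
    where
    1+a≤A+l′ : a ≤ l′ ⊎ b ≤ l′ → 1 + a ≤ A + l′
    1+a≤A+l′ (inj₁ a≤l′) = +-mono-≤ 1≤A a≤l′
    1+a≤A+l′ (inj₂ b≤l′) = ≤-trans a<A+b (+-monoʳ-≤ A b≤l′)

  ¬resolving-of-equidistant : ∀ {W x y} → x ≢ y →
    (∀ {w a b} → w ∈ W → Dist G x w a → Dist G y w b → a ≡ b) → ¬ Resolving G W
  ¬resolving-of-equidistant x≢y equidistant resolving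
    with _ , w∈W , _ , _ , dx , dy , a≢b ← resolving _ _ x≢y
    = a≢b (equidistant w∈W dx dy)

data Side : Set where
  left right : Side

other : Side → Side
other left  = right
other right = left

-- Internal vertices are numbered from the c₁ side; steps e j is the distance along the path to the
-- centre on side e.
steps : ∀ {n} → Side → Fin n → ℕ
steps left  j = suc (toℕ j)
steps right j = suc (toℕ (opposite j))

steps-positive : ∀ {n} e (j : Fin n) → 0 < steps e j
steps-positive left  _ = s≤s z≤n
steps-positive right _ = s≤s z≤n

steps≤n : ∀ {n} e (j : Fin n) → steps e j ≤ n
steps≤n left  j = FinP.toℕ<n j
steps≤n right j = FinP.toℕ<n (opposite j)

side-index : ∀ {n} e → 1 ≤ n → Σ[ j ∈ Fin n ] steps e j ≡ 1 × steps (other e) j ≡ n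
side-index {n} left 1≤n = first , cong suc first≡0 , last-steps
  where
  first : Fin n
  first = fromℕ< 1≤n
  first≡0 : toℕ first ≡ 0
  first≡0 = FinP.toℕ-fromℕ< 1≤n
  last-steps : steps right first ≡ n
  last-steps = subst (λ k → k + steps right first ≡ n) first≡0 (toℕ+suc-toℕ-opposite first)
side-index right 1≤n with first , first-steps , last-steps ← side-index left 1≤n
  = opposite first , trans (cong (suc ∘ toℕ) (FinP.opposite-involutive first)) first-steps , last-steps

module ThetaPaths {m : ℕ} (s : Fin m → ℕ) where
  Γ : Graph
  Γ = Theta s

  open GraphWalks Γ public

  adj-sym : ∀ {u v} → Graph.Adj Γ u v → Graph.Adj Γ v u
  adj-sym = Sum.swap

  OnPath : Fin m → ThetaV s → Set
  OnPath i w = ∃[ j ] w ≡ int i j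

  Avoids : List (ThetaV s) → Fin m → Set
  Avoids W i = ∀ {w} → w ∈ W → ¬ OnPath i w

  onPath-unique : ∀ {i i′ w} → OnPath i w → OnPath i′ w → i ≡ i′
  onPath-unique (_ , refl) (_ , refl) = refl

  avoids-one-of : ∀ {i i′} → i ≢ i′ → ∀ w → ¬ OnPath i w ⊎ ¬ OnPath i′ w
  avoids-one-of i≢i′ c₁ = inj₁ λ ()
  avoids-one-of i≢i′ c₂ = inj₁ λ ()
  avoids-one-of {i} i≢i′ (int k j) with i FinP.≟ k
  ... | yes refl = inj₂ λ on-i′ → i≢i′ (onPath-unique (j , refl) on-i′)
  ... | no i≢k   = inj₁ λ on-i → i≢k (onPath-unique on-i (j , refl))

  walk-to-c₁ : ∀ i n (j : Fin (s i)) → toℕ j ≡ n → Walk Γ (int i j) c₁ (suc n)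
  walk-to-c₁ i zero    j j≡0   = inj₂ (start i j j≡0) ∷ []
  walk-to-c₁ i (suc n) j j≡1+n = inj₂ (step i k j j≡1+k) ∷ walk-to-c₁ i n k (FinP.toℕ-fromℕ< n<s)
    where
    n<s : n < s i
    n<s = <-trans (n<1+n n) (subst (_< s i) j≡1+n (FinP.toℕ<n j))
    k : Fin (s i)
    k = fromℕ< n<s
    j≡1+k : toℕ j ≡ suc (toℕ k)
    j≡1+k = trans j≡1+n (cong suc (sym (FinP.toℕ-fromℕ< n<s)))

  walk-to-c₂ : ∀ i d (j : Fin (s i)) → s i ≡ toℕ j + suc d → Walk Γ (int i j) c₂ (suc d)
  walk-to-c₂ i zero    j s≡j+1 = inj₁ (end i j (sym (trans s≡j+1 (+-comm (toℕ j) 1)))) ∷ []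
  walk-to-c₂ i (suc d) j s≡j+2+d = inj₁ (step i j k k≡1+j) ∷ walk-to-c₂ i d k s≡k+1+d
    where
    s≡1+j+1+d : s i ≡ suc (toℕ j) + suc d
    s≡1+j+1+d = trans s≡j+2+d (+-suc (toℕ j) (suc d))
    1+j<s : suc (toℕ j) < s i
    1+j<s = subst (suc (toℕ j) <_) (sym s≡1+j+1+d) (m<m+n (suc (toℕ j)) (s≤s z≤n))
    k : Fin (s i)
    k = fromℕ< 1+j<s
    k≡1+j : toℕ k ≡ suc (toℕ j)
    k≡1+j = FinP.toℕ-fromℕ< 1+j<s
    s≡k+1+d : s i ≡ toℕ k + suc d
    s≡k+1+d = trans s≡1+j+1+d (cong (_+ suc d) (sym k≡1+j))

  leave-path : ∀ i d (j : Fin (s i)) {w l} → ¬ OnPath i w → s i ≡ toℕ j + suc d →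
          Walk Γ (int i j) w l → Through c₁ (suc (toℕ j)) w l ⊎ Through c₂ (suc d) w l
  leave-path i d j w∉i _ [] = ⊥-elim (w∉i (j , refl))
  leave-path i zero j _ s≡j+1 (inj₁ (step _ _ k k≡1+j) ∷ _) =
    ⊥-elim (<-irrefl (trans k≡1+j (sym (trans s≡j+1 (+-comm (toℕ j) 1)))) (FinP.toℕ<n k))
  leave-path i (suc d) j w∉i s≡j+2+d (inj₁ (step _ _ k k≡1+j) ∷ p) =
    Sum.map (through-mono (n≤1+n _) (n≤1+n _) ∘ subst (λ n → Through c₁ (suc n) _ _) k≡1+j)
            through-suc
            (leave-path i d k w∉i s≡k+1+d p)
    where
    s≡k+1+d : s i ≡ toℕ k + suc d
    s≡k+1+d = trans s≡j+2+d (trans (+-suc (toℕ j) (suc d)) (cong (_+ suc d) (sym k≡1+j)))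
  leave-path i zero j _ _ (inj₁ (end _ _ _) ∷ p) = inj₂ (_ , p , ≤-refl)
  leave-path i (suc d) j _ s≡j+2+d (inj₁ (end _ _ 1+j≡s) ∷ _) =
    ⊥-elim (m+1+n≢m (toℕ j) (sym (suc-injective (trans (trans 1+j≡s s≡j+2+d) (+-suc (toℕ j) (suc d))))))
  leave-path i d j _ _ (_∷_ {k = l} (inj₂ (start _ _ j≡0)) p) =
    inj₁ (l , p , subst (λ n → suc n + l ≤ suc l) (sym j≡0) ≤-refl)
  leave-path i d j w∉i s≡j+1+d (inj₂ (step _ k _ j≡1+k) ∷ p) =
    Sum.map (subst (λ n → Through c₁ (suc n) _ _) (sym j≡1+k) ∘ through-suc)
            (through-mono (n≤1+n _) (n≤1+n _))
            (leave-path i (suc d) k w∉i s≡k+2+d p)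
    where
    s≡k+2+d : s i ≡ toℕ k + suc (suc d)
    s≡k+2+d = trans s≡j+1+d (trans (cong (_+ suc d) j≡1+k) (sym (+-suc (toℕ k) (suc d))))

  centre : Side → ThetaV s
  centre left  = c₁
  centre right = c₂

  centre-off-path : ∀ e i → ¬ OnPath i (centre e)
  centre-off-path left  i ()
  centre-off-path right i ()

  walk-to-centre : ∀ e i (j : Fin (s i)) → Walk Γ (int i j) (centre e) (steps e j)
  walk-to-centre left  i j = walk-to-c₁ i (toℕ j) j refl
  walk-to-centre right i j = walk-to-c₂ i _ j (sym (toℕ+suc-toℕ-opposite j))

  leave-via : ∀ e i (j : Fin (s i)) {w l} → ¬ OnPath i w → Walk Γ (int i j) w l →
              Through (centre e) (steps e j) w l ⊎ Through (centre (other e)) (steps (other e) j) w l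
  leave-via left  i j w∉i = leave-path i _ j w∉i (sym (toℕ+suc-toℕ-opposite j))
  leave-via right i j w∉i = Sum.swap ∘ leave-path i _ j w∉i (sym (toℕ+suc-toℕ-opposite j))

  PrefersSide : Side → ℕ → ThetaV s → Set
  PrefersSide e = Prefers (centre e) (centre (other e))

  prefers-int : ∀ e i (j : Fin (s i)) {A} → 1 ≤ A → steps e j < A + steps (other e) j →
                PrefersSide e A (int i j)
  prefers-int e i j 1≤A near<A+far =
    prefers-of-walks 1≤A near<A+far (reverse adj-sym (walk-to-centre e i j)) λ far→int →
      Sum.map through-≤ through-≤
        (leave-via e i j (centre-off-path (other e) i) (reverse adj-sym far→int))

  some-side-preferred : ∀ {A} → 1 ≤ A → ∀ w → ∃[ e ] PrefersSide e A w
  some-side-preferred 1≤A c₁ = left , prefers-self 1≤A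
  some-side-preferred 1≤A c₂ = right , prefers-self 1≤A
  some-side-preferred 1≤A (int i j) with ≤-total (steps left j) (steps right j)
  ... | inj₁ left≤right = left  , prefers-int left  i j 1≤A (+-mono-≤ 1≤A left≤right)
  ... | inj₂ right≤left = right , prefers-int right i j 1≤A (+-mono-≤ 1≤A right≤left)

  every-side-preferred : ∀ {A i} → 1 ≤ A → s i ≤ A → ∀ e (j : Fin (s i)) → PrefersSide e A (int i j)
  every-side-preferred {A} 1≤A s≤A e j =
    prefers-int e _ j 1≤A (≤-<-trans (≤-trans (steps≤n e j) s≤A) (m<m+n A (steps-positive (other e) j)))

  record SideNeighbour (e : Side) (i : Fin m) : Set where
    field
      index  : Fin (s i)
      near   : Walk Γ (int i index) (centre e) 1
      far    : Walk Γ (int i index) (centre (other e)) (s i)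
      leaves : ∀ {w l} → ¬ OnPath i w → Walk Γ (int i index) w l →
               Through (centre e) 1 w l ⊎ Through (centre (other e)) (s i) w l

  side-neighbour : ∀ e i → 1 ≤ s i → SideNeighbour e i
  side-neighbour e i 1≤s with j , near-steps , far-steps ← side-index e 1≤s = record
    { index  = j
    ; near   = subst (Walk Γ _ _) near-steps (walk-to-centre e i j)
    ; far    = subst (Walk Γ _ _) far-steps (walk-to-centre (other e) i j)
    ; leaves = λ w∉i →
        Sum.map (subst (λ n → Through _ n _ _) near-steps) (subst (λ n → Through _ n _ _) far-steps)
        ∘ leave-via e i j w∉i
    }

  open SideNeighbour

  dist-≤-from-shorter : ∀ {e a b w da db} (x : SideNeighbour e a) (y : SideNeighbour e b) →
    s a ≤ s b → ¬ OnPath b w → Dist Γ (int a (index x)) w da → Dist Γ (int b (index y)) w db → da ≤ db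
  dist-≤-from-shorter x y sa≤sb w∉b dx (y→w , _) =
    [ (λ via-near → dist-≤-through (near x) via-near dx)
    , (λ via-far → dist-≤-through (far x) (through-mono sa≤sb ≤-refl via-far) dx)
    ]′ (leaves y w∉b y→w)

  side-neighbours-unresolved : ∀ e {a b W} → a ≢ b → Avoids W a → Avoids W b → 1 ≤ s a → s a ≤ s b →
    s a ≡ s b ⊎ (∀ {w} → w ∈ W → PrefersSide e (s a) w) → ¬ Resolving Γ W
  side-neighbours-unresolved e {a} {b} {W} a≢b avoids-a avoids-b 1≤sa sa≤sb condition =
    ¬resolving-of-equidistant (λ x≡y → a≢b (onPath-unique (_ , refl) (_ , x≡y))) equidistant
    where
    x : SideNeighbour e a
    x = side-neighbour e a 1≤sa
    y : SideNeighbour e b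
    y = side-neighbour e b (≤-trans 1≤sa sa≤sb)
    equidistant : ∀ {w da db} → w ∈ W →
      Dist Γ (int a (index x)) w da → Dist Γ (int b (index y)) w db → da ≡ db
    equidistant {da = da} {db} w∈W dx dy =
      ≤-antisym (dist-≤-from-shorter x y sa≤sb (avoids-b w∈W) dx dy) db≤da
      where
      db≤da : db ≤ da
      db≤da = [ (λ sa≡sb → dist-≤-from-shorter y x (≤-reflexive (sym sa≡sb)) (avoids-a w∈W) dy dx)
              , (λ prefers → dist-≤-through (near y)
                   ([ (λ via-near → via-near) , prefers w∈W ]′ (leaves x (avoids-a w∈W) (proj₁ dx))) dy)
              ]′ condition

module ShortAndLongPaths (p q s₁ : ℕ) (t : Fin q → ℕ) (1≤s₁ : 1 ≤ s₁) (s₁<t : ∀ y → s₁ < t y) where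
  s : Fin (p + q) → ℕ
  s = lengths p q s₁ t

  open ThetaPaths s

  short : Fin p → Fin (p + q)
  short x = x ↑ˡ q

  long : Fin q → Fin (p + q)
  long y = p ↑ʳ y

  s-short : ∀ x → s (short x) ≡ s₁
  s-short x rewrite FinP.splitAt-↑ˡ p x q = refl

  s-long : ∀ y → s (long y) ≡ t y
  s-long y rewrite FinP.splitAt-↑ʳ p q y = refl

  s₁≤s : ∀ i → s₁ ≤ s i
  s₁≤s i with splitAt p i
  ... | inj₁ _ = ≤-refl
  ... | inj₂ y = <⇒≤ (s₁<t y)

  1≤s : ∀ i → 1 ≤ s i
  1≤s i = ≤-trans 1≤s₁ (s₁≤s i)

  short≢long : ∀ x y → short x ≢ long y
  short≢long x y short≡long = inj₁≢inj₂ (begin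
    inj₁ x                   ≡⟨ FinP.splitAt-↑ˡ p x q ⟨
    splitAt p (short x)      ≡⟨ cong (splitAt p) short≡long ⟩
    splitAt p (long y)       ≡⟨ FinP.splitAt-↑ʳ p q y ⟩
    inj₂ y                   ∎)
    where
    open ≡-Reasoning
    inj₁≢inj₂ : inj₁ x ≢ inj₂ y
    inj₁≢inj₂ ()

  long-avoiding : ∀ {y₀ y₁} → y₀ ≢ y₁ → ∀ w → ∃[ y ] ¬ OnPath (long y) w
  long-avoiding {y₀} {y₁} y₀≢y₁ w =
    [ (y₀ ,_) , (y₁ ,_) ]′ (avoids-one-of (y₀≢y₁ ∘ FinP.↑ʳ-injective p y₀ y₁) w)

  short-index : ThetaV s → Maybe (Fin p)
  short-index c₁        = nothing
  short-index c₂        = nothing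
  short-index (int i _) = isInj₁ (splitAt p i)

  short-index-int : ∀ x j → short-index (int (short x) j) ≡ just x
  short-index-int x j = cong isInj₁ (FinP.splitAt-↑ˡ p x q)

  on-short-index : ∀ {w x} → short-index w ≡ just x → OnPath (short x) w
  on-short-index {int i j} short-index≡x
    with refl ← FinP.splitAt⁻¹-↑ˡ (isInj₁≡just⇒≡inj₁ (splitAt p i) short-index≡x)
    = j , refl

  short-index-avoids-long : ∀ {w x} y → short-index w ≡ just x → ¬ OnPath (long y) w
  short-index-avoids-long {x = x} y short-index≡x on-long =
    short≢long x y (onPath-unique (on-short-index short-index≡x) on-long)

  short-index-prefers : ∀ {w x A} → short-index w ≡ just x → 1 ≤ A → s₁ ≤ A → ∀ e → PrefersSide e A w
  short-index-prefers {w} {x} {A} short-index≡x 1≤A s₁≤A e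
    with j , refl ← on-short-index {w} short-index≡x =
    every-side-preferred 1≤A (subst (_≤ A) (sym (s-short x)) s₁≤A) e j

  module _ (W : List (ThetaV s)) where
    short-indices : List (Fin p)
    short-indices = mapMaybe short-index W

    others : List (ThetaV s)
    others = rejected short-index W

    classify : ∀ {w} → w ∈ W → (∃[ x ] short-index w ≡ just x) ⊎ w ∈ others
    classify {w} w∈W with short-index w in short-index≡
    ... | just x  = inj₁ (x , refl)
    ... | nothing = inj₂ (∈-rejected short-index w∈W short-index≡)

    length-short-indices+others : length W ≤ p → length short-indices + length others ≤ p
    length-short-indices+others = subst (_≤ p) (sym (length-mapMaybe+rejected short-index W))

    avoids-missing-short : ∀ {x} → x ∉ short-indices → Avoids W (short x)
    avoids-missing-short x∉ w∈W (j , refl) = x∉ (∈-mapMaybe short-index w∈W (short-index-int _ j))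

    avoids-long : ∀ {y} → All (¬_ ∘ OnPath (long y)) others → Avoids W (long y)
    avoids-long {y} others-avoid w∈W =
      [ (λ (_ , short-index≡x) → short-index-avoids-long y short-index≡x) , All.lookup others-avoid
      ]′ (classify w∈W)

    prefers : ∀ {e A} → 1 ≤ A → s₁ ≤ A → All (PrefersSide e A) others →
              ∀ {w} → w ∈ W → PrefersSide e A w
    prefers {e} 1≤A s₁≤A others-prefer w∈W =
      [ (λ (_ , short-index≡x) → short-index-prefers short-index≡x 1≤A s₁≤A e) , All.lookup others-prefer
      ]′ (classify w∈W)

    unresolved-if-no-others : ∀ {y y′} → y ≢ y′ → t y ≤ t y′ → others ≡ [] → ¬ Resolving Γ W
    unresolved-if-no-others {y} {y′} y≢y′ ty≤ty′ no-others =
      side-neighbours-unresolved left (y≢y′ ∘ FinP.↑ʳ-injective p y y′)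
        (avoids-long vacuous) (avoids-long vacuous)
        (1≤s (long y)) (subst₂ _≤_ (sym (s-long y)) (sym (s-long y′)) ty≤ty′)
        (inj₂ (prefers (1≤s (long y)) (s₁≤s (long y)) vacuous))
      where
      vacuous : ∀ {P : ThetaV s → Set} → All P others
      vacuous = subst (All _) (sym no-others) []

    unresolved-if-one-other : ∀ {y₀ y₁ e} → y₀ ≢ y₁ → length W ≤ p → others ≡ e ∷ [] → ¬ Resolving Γ W
    unresolved-if-one-other {e = e} y₀≢y₁ |W|≤p others≡[e] =
      let x , x∉ = ∃∉-of-length< short-indices |short-indices|<p
          y , e∉y = long-avoiding y₀≢y₁ e
          σ , e-prefers = some-side-preferred (1≤s (short x)) e
      in side-neighbours-unresolved σ (short≢long x y)
           (avoids-missing-short x∉) (avoids-long (only-e e∉y))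
           (1≤s (short x)) (subst₂ _≤_ (sym (s-short x)) (sym (s-long y)) (<⇒≤ (s₁<t y)))
           (inj₂ (prefers (1≤s (short x)) (≤-reflexive (sym (s-short x))) (only-e e-prefers)))
      where
      only-e : ∀ {P : ThetaV s → Set} → P e → All P others
      only-e Pe = subst (All _) (sym others≡[e]) (Pe ∷ [])
      |short-indices|<p : length short-indices < p
      |short-indices|<p = begin-strict
        length short-indices                    <⟨ m<m+n _ (≤-reflexive (sym (cong length others≡[e]))) ⟩
        length short-indices + length others    ≤⟨ length-short-indices+others |W|≤p ⟩
        p                                       ∎
        where open ≤-Reasoning

    unresolved-if-two-others : length W ≤ p → 2 ≤ length others → ¬ Resolving Γ W
    unresolved-if-two-others |W|≤p 2≤|others| =
      let x , x′ , x≢x′ , x∉ , x′∉ = two-∉-of-length short-indices 2+|short-indices|≤p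
          sx≡sx′ : s (short x) ≡ s (short x′)
          sx≡sx′ = trans (s-short x) (sym (s-short x′))
      in side-neighbours-unresolved left (x≢x′ ∘ FinP.↑ˡ-injective q x x′)
           (avoids-missing-short x∉) (avoids-missing-short x′∉)
           (1≤s (short x)) (≤-reflexive sx≡sx′) (inj₁ sx≡sx′)
      where
      2+|short-indices|≤p : 2 + length short-indices ≤ p
      2+|short-indices|≤p = begin
        2 + length short-indices                ≡⟨ +-comm 2 (length short-indices) ⟩
        length short-indices + 2                ≤⟨ +-monoʳ-≤ (length short-indices) 2≤|others| ⟩
        length short-indices + length others    ≤⟨ length-short-indices+others |W|≤p ⟩
        p                                       ∎
        where open ≤-Reasoning

  unresolved-if-length≤p : ∀ {y y′} → y ≢ y′ → t y ≤ t y′ → ∀ W → length W ≤ p → ¬ Resolving Γ W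
  unresolved-if-length≤p y≢y′ ty≤ty′ W |W|≤p with others W in others≡
  ... | []         = unresolved-if-no-others W y≢y′ ty≤ty′ others≡
  ... | _ ∷ []     = unresolved-if-one-other W y≢y′ |W|≤p others≡
  ... | _ ∷ _ ∷ _  =
    unresolved-if-two-others W |W|≤p (subst (λ os → 2 ≤ length os) (sym others≡) (s≤s (s≤s z≤n)))

mainTheorem6 : (p q s₁ : ℕ) (t : Fin q → ℕ) →
    2 ≤ p → 2 ≤ q →
    1 ≤ s₁ →
    (∀ i j → i F.≤ j → t i ≤ t j) →
    (∀ j → s₁ < t j) →
    MetricDimAtLeast (Theta (lengths p q s₁ t)) (p + 1)
mainTheorem6 p q s₁ t _ 2≤q 1≤s₁ t-mono s₁<t W resolving
  with y , y′ , y≢y′ , ty≤ty′ ← two-ordered-indices t t-mono 2≤q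
  = subst (_≤ length W) (+-comm 1 p) (≮⇒≥ λ |W|<1+p →
      ShortAndLongPaths.unresolved-if-length≤p p q s₁ t 1≤s₁ s₁<t y≢y′ ty≤ty′ W
        (s≤s⁻¹ |W|<1+p) resolving)
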